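{- Let $(G,l)$ be a loopless model of a metric graph, let $K$ be a subgroup of $\mathrm{Aut}(G,l)$, and let $(G/K,l')$ be the quotient. Then the quotient morphism $\pi_K:(G,l)\to(G/K,l')$ is a harmonic morphism. If the graph $G/K$ does not consist of a single vertex, then $\pi_K$ is nondegenerate of degree $|K|$.
   Context: $(G,l)$: a finite connected graph $G$ without loops and $l:E(G)\to\mathbb{R}_{>0}$. $\mathrm{Aut}(G,l)$ is the group of graph automorphisms of $G$ preserving $l$. The quotient $(G/K,l')$: vertices are the $K$-orbits $[v]$ of $V(G)$; edges are the $K$-orbits $[e]$ of edges $e=xy$ with $x,y$ in distinct $K$-orbits; $l'([e])=l(e)\cdot|\mathrm{Stab}_K(e)|$. The quotient morphism $\pi_K$ sends $v\mapsto[v]$, an edge with $K$-equivalent ends $x,y$ to the vertex $[x]=[y]$, and an edge $e$ with $K$-inequivalent ends to $[e]$. A morphism of loopless models $\phi:(G,l)\to(G',l')$ is a map $V(G)\cup E(G)\to V(G')\cup E(G')$ with $\phi(V(G))\subseteq V(G')$, such that an edge $xy$ mapped to a vertex has both ends mapped to that vertex, and an edge mapped to an edge $e'$ has $e'$ joining $\phi(x),\phi(y)$ with $\mu_\phi(e)=l'(e')/l(e)\in\mathbb{Z}$. It is harmonic if for every $x\in V(G)$, $m_\phi(x)=\sum_{e\ni x,\phi(e)=e'}\mu_\phi(e)$ is independent of the edge $e'$ incident to $\phi(x)$; nondegenerate if all $m_\phi(x)>0$; its degree is $\sum_{\phi(e)=e'}\mu_\phi(e)$ for any $e'\in E(G')$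 (and $0$ if $G'$ has no edges). -}

module Defs where

open import Data.Nat using (ℕ; zero; suc; _+_; _<_)
open import Data.Fin using (Fin; zero; suc; _≟_)
open import Data.Bool using (Bool; true; false; if_then_else_; _∧_; _∨_)
open import Data.Sum using (_⊎_; inj₁; inj₂)
open import Data.Product using (Σ; ∃; _×_; _,_)
open import Relation.Nullary using (¬_)
open import Relation.Nullary.Decidable using (⌊_⌋)
open import Relation.Binary.PropositionalEquality using (_≡_; _≢_)

sumFin : (n : ℕ) → (Fin n → ℕ) → ℕ
sumFin zero    f = 0
sumFin (suc n) f = f zero + sumFin n (λ i → f (suc i))

countFin : (n : ℕ) → (Fin n → Bool) → ℕ
countFin n p = sumFin n (λ i → if p i then 1 else 0)

-- There are no real numbers in agda-stdlib, so lengths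
-- live in an abstract domain L (e.g. ℝ) with a positivity predicate and
-- scalar multiplication by naturals; for positive x, n·x determines n
-- (true in ℝ), so the integer ratio l'(e')/l(e) is well defined.

record LengthDomain : Set₁ where
  field
    L      : Set
    _·_    : ℕ → L → L
    Pos    : L → Set
    cancel : ∀ {x} → Pos x → ∀ m n → m · x ≡ n · x → m ≡ n

record Model (D : LengthDomain) : Set where
  open LengthDomain D
  field
    nV nE    : ℕ
    src tgt  : Fin nE → Fin nV
    loopless : ∀ e → src e ≢ tgt e
    len      : Fin nE → L
    len-pos  : ∀ e → Pos (len e)

module _ {D : LengthDomain} where
  open Model

  Joins : (M : Model D) → Fin (nE M) → Fin (nV M) → Fin (nV M) → Set
  Joins M e x y = (src M e ≡ x × tgt M e ≡ y) ⊎ (src M e ≡ y × tgt M e ≡ x)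

  Incident : (M : Model D) → Fin (nE M) → Fin (nV M) → Set
  Incident M e x = src M e ≡ x ⊎ tgt M e ≡ x

  incident? : (M : Model D) → Fin (nE M) → Fin (nV M) → Bool
  incident? M e x = ⌊ src M e ≟ x ⌋ ∨ ⌊ tgt M e ≟ x ⌋

  data Path (M : Model D) : Fin (nV M) → Fin (nV M) → Set where
    here : ∀ {x} → Path M x x
    step : ∀ {x y z} (e : Fin (nE M)) → Joins M e x y → Path M y z → Path M x z

  Connected : Model D → Set
  Connected M = (0 < nV M) × (∀ x y → Path M x y)

  record Aut (M : Model D) : Set where
    field
      fV fV⁻ : Fin (nV M) → Fin (nV M)
      fE fE⁻ : Fin (nE M) → Fin (nE M)
      fV-inv₁ : ∀ x → fV⁻ (fV x) ≡ x
      fV-inv₂ : ∀ x → fV (fV⁻ x) ≡ x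
      fE-inv₁ : ∀ e → fE⁻ (fE e) ≡ e
      fE-inv₂ : ∀ e → fE (fE⁻ e) ≡ e
      incid   : ∀ e → Joins M (fE e) (fV (src M e)) (fV (tgt M e))
      len-pres : ∀ e → len M (fE e) ≡ len M e

  _≈A_ : {M : Model D} → Aut M → Aut M → Set
  _≈A_ {M} σ τ = (∀ x → Aut.fV σ x ≡ Aut.fV τ x) × (∀ e → Aut.fE σ e ≡ Aut.fE τ e)

  -- a subgroup K of Aut(G,l), listed without repetition as elt : Fin k → Aut;
  -- so |K| = k.
  record Subgroup (M : Model D) : Set where
    field
      k     : ℕ
      elt   : Fin k → Aut M
      distinct : ∀ i j → elt i ≈A elt j → i ≡ j
      has-id   : ∃ λ i → (∀ x → Aut.fV (elt i) x ≡ x) × (∀ e → Aut.fE (elt i) e ≡ e)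
      closed   : ∀ i j → ∃ λ r →
                   (∀ x → Aut.fV (elt r) x ≡ Aut.fV (elt i) (Aut.fV (elt j) x)) ×
                   (∀ e → Aut.fE (elt r) e ≡ Aut.fE (elt i) (Aut.fE (elt j) e))
      has-inv  : ∀ i → ∃ λ j →
                   (∀ x → Aut.fV (elt j) (Aut.fV (elt i) x) ≡ x) ×
                   (∀ e → Aut.fE (elt j) (Aut.fE (elt i) e) ≡ e)

  module _ {M : Model D} (K : Subgroup M) where
    open Subgroup K

    VEquiv : Fin (nV M) → Fin (nV M) → Set
    VEquiv x y = ∃ λ i → Aut.fV (elt i) x ≡ y

    EEquiv : Fin (nE M) → Fin (nE M) → Set
    EEquiv e₁ e₂ = ∃ λ i → Aut.fE (elt i) e₁ ≡ e₂

    stab : Fin (nE M) → ℕ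
    stab e = countFin k (λ i → ⌊ Aut.fE (elt i) e ≟ e ⌋)

  record Map (M M' : Model D) : Set where
    field
      φV : Fin (nV M) → Fin (nV M')
      φE : Fin (nE M) → Fin (nV M') ⊎ Fin (nE M')

  hits? : ∀ {a b} → Fin a ⊎ Fin b → Fin b → Bool
  hits? (inj₁ _) e' = false
  hits? (inj₂ e) e' = ⌊ e ≟ e' ⌋

  -- (M' , π) is the quotient (G/K , l') together with π_K: vertices of M'
  -- are identified with K-orbits of vertices, edges of M' with K-orbits of
  -- edges with K-inequivalent ends, and l'([e]) = |Stab_K(e)| · l(e).
  record IsQuotient {M : Model D} (K : Subgroup M) (M' : Model D)
                    (π : Map M M') : Set where
    open LengthDomain D
    open Map π
    field
      V-surj : ∀ v' → ∃ λ x → φV x ≡ v'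
      V-ker₁ : ∀ x y → φV x ≡ φV y → VEquiv K x y
      V-ker₂ : ∀ x y → VEquiv K x y → φV x ≡ φV y
      E-vert : ∀ e → VEquiv K (src M e) (tgt M e) → φE e ≡ inj₁ (φV (src M e))
      E-edge : ∀ e → ¬ VEquiv K (src M e) (tgt M e) → ∃ λ e' → φE e ≡ inj₂ e'
      E-surj : ∀ e' → ∃ λ e → φE e ≡ inj₂ e'
      E-ker₁ : ∀ e₁ e₂ e' → φE e₁ ≡ inj₂ e' → φE e₂ ≡ inj₂ e' → EEquiv K e₁ e₂
      E-ker₂ : ∀ e₁ e₂ e' → φE e₁ ≡ inj₂ e' → EEquiv K e₁ e₂ → φE e₂ ≡ inj₂ e'
      E-ends : ∀ e e' → φE e ≡ inj₂ e' → Joins M' e' (φV (src M e)) (φV (tgt M e))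
      E-len  : ∀ e e' → φE e ≡ inj₂ e' → len M' e' ≡ (stab K e · len M e)

  -- π is a morphism of loopless models, with local multiplicities μ
  -- (μ e = l'(e')/l(e) for edges e mapped to edges e'; irrelevant otherwise)
  record IsMorphism {M M' : Model D} (π : Map M M') : Set where
    open LengthDomain D
    open Map π
    field
      μ      : Fin (nE M) → ℕ
      toVert : ∀ e v → φE e ≡ inj₁ v → φV (src M e) ≡ v × φV (tgt M e) ≡ v
      toEdge : ∀ e e' → φE e ≡ inj₂ e' →
                 Joins M' e' (φV (src M e)) (φV (tgt M e)) × len M' e' ≡ (μ e · len M e)

  module _ {M M' : Model D} {π : Map M M'} (φ : IsMorphism π) where
    open Map π
    open IsMorphism φ

    mult : Fin (nV M) → Fin (nE M') → ℕ
    mult x e' = sumFin (nE M) (λ e →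
                  if incident? M e x ∧ hits? (φE e) e' then μ e else 0)

    IsHarmonic : Set
    IsHarmonic = ∀ x e₁ e₂ → Incident M' e₁ (φV x) → Incident M' e₂ (φV x) →
                 mult x e₁ ≡ mult x e₂

    IsNondegenerate : Set
    IsNondegenerate = ∀ x e' → Incident M' e' (φV x) → 0 < mult x e'

    degAt : Fin (nE M') → ℕ
    degAt e' = sumFin (nE M) (λ e → if hits? (φE e) e' then μ e else 0)

    HasDegree : ℕ → Set
    HasDegree d = (∀ e' → degAt e' ≡ d) × (nE M' ≡ 0 → d ≡ 0)

-- The edges of G over an edge e′ of G/K form the K-orbit of any one of them, e₀, and for e
-- in that orbit |Stab_K(e)| = #{g ∈ K | g e₀ = e}. So sums over the edges above e′, weighted
-- by l′/l = |Stab_K(e)|, become sums over K: the degree is |K|, and the multiplicity at x is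
-- #{g | x is an end of g e₀}. Exactly one end u of e₀ lies in the orbit of x, so this count is
-- #{g | g u = x} = |Stab_K(x)|, independent of e′ and positive. Connectedness of G supplies an
-- edge of G/K as soon as G/K has two vertices.

module Submission where

open import Defs
open import Data.Bool using (Bool; true; false; if_then_else_; _∧_; _∨_)
open import Data.Bool.Properties using (∨-comm; ∨-identityʳ; if-∧; if-swap-then)
open import Data.Empty using (⊥-elim)
open import Data.Fin using (Fin; zero; suc; _≟_; fromℕ<)
open import Data.Fin.Properties using (suc-injective; ¬Fin0)
import Data.Fin.Permutation as Permutation
open import Data.Nat using (ℕ; zero; suc; _+_; _<_; s≤s; z≤n)
open import Data.Nat.Properties using (+-0-commutativeMonoid; +-identityʳ; ≤-trans; m≤n+m)
open import Data.Product using (Σ; ∃; ∃₂; _×_; _,_; proj₁; proj₂)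
open import Data.Sum using (_⊎_; inj₁; inj₂)
open import Data.Sum.Properties using (inj₁-injective)
open import Relation.Nullary using (¬_; yes; no)
open import Relation.Nullary.Decidable using (⌊_⌋; isYes≗does; dec-true; dec-false)
open import Relation.Binary.PropositionalEquality
  using (_≡_; _≢_; refl; sym; trans; cong; cong₂; subst; module ≡-Reasoning)
import Algebra.Properties.CommutativeMonoid.Sum as CommutativeMonoidSum

open ≡-Reasoning

module ℕ-Sum = CommutativeMonoidSum +-0-commutativeMonoid

⌊≟⌋-true : ∀ {n} {x y : Fin n} → x ≡ y → ⌊ x ≟ y ⌋ ≡ true
⌊≟⌋-true {x = x} {y} p = trans (isYes≗does (x ≟ y)) (dec-true (x ≟ y) p)

⌊≟⌋-false : ∀ {n} {x y : Fin n} → x ≢ y → ⌊ x ≟ y ⌋ ≡ false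
⌊≟⌋-false {x = x} {y} p = trans (isYes≗does (x ≟ y)) (dec-false (x ≟ y) p)

sumFin≡sum : ∀ n (f : Fin n → ℕ) → sumFin n f ≡ ℕ-Sum.sum f
sumFin≡sum zero    f = refl
sumFin≡sum (suc n) f = cong (f zero +_) (sumFin≡sum n (λ i → f (suc i)))

sumFin-cong : ∀ n {f g : Fin n → ℕ} → (∀ i → f i ≡ g i) → sumFin n f ≡ sumFin n g
sumFin-cong zero    eq = refl
sumFin-cong (suc n) eq = cong₂ _+_ (eq zero) (sumFin-cong n (λ i → eq (suc i)))

sumFin-zero : ∀ n {f : Fin n → ℕ} → (∀ i → f i ≡ 0) → sumFin n f ≡ 0
sumFin-zero zero    eq = refl
sumFin-zero (suc n) eq = cong₂ _+_ (eq zero) (sumFin-zero n (λ i → eq (suc i)))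

sumFin-single : ∀ n {f : Fin n → ℕ} (a : Fin n) → (∀ i → a ≢ i → f i ≡ 0) → sumFin n f ≡ f a
sumFin-single (suc n) {f} zero    h =
  trans (cong (f zero +_) (sumFin-zero n (λ i → h (suc i) (λ ())))) (+-identityʳ _)
sumFin-single (suc n)     (suc a) h =
  cong₂ _+_ (h zero (λ ()))
            (sumFin-single n a (λ i a≢i → h (suc i) (λ eq → a≢i (suc-injective eq))))

sumFin-comm : ∀ m n (f : Fin m → Fin n → ℕ) →
  sumFin m (λ i → sumFin n (f i)) ≡ sumFin n (λ j → sumFin m (λ i → f i j))
sumFin-comm m n f = begin
  sumFin m (λ i → sumFin n (f i))           ≡⟨ sumFin-cong m (λ i → sumFin≡sum n (f i)) ⟩
  sumFin m (λ i → ℕ-Sum.sum (f i))          ≡⟨ sumFin≡sum m _ ⟩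
  ℕ-Sum.sum (λ i → ℕ-Sum.sum (f i))         ≡⟨ ℕ-Sum.∑-comm f ⟩
  ℕ-Sum.sum (λ j → ℕ-Sum.sum (λ i → f i j)) ≡⟨ sumFin≡sum n _ ⟨
  sumFin n (λ j → ℕ-Sum.sum (λ i → f i j))  ≡⟨ sumFin-cong n (λ j → sumFin≡sum m (λ i → f i j)) ⟨
  sumFin n (λ j → sumFin m (λ i → f i j))   ∎

sumFin-permute : ∀ n (w : Fin n → ℕ) (σ σ⁻¹ : Fin n → Fin n) →
  (∀ i → σ (σ⁻¹ i) ≡ i) → (∀ i → σ⁻¹ (σ i) ≡ i) →
  sumFin n (λ i → w (σ i)) ≡ sumFin n w
sumFin-permute n w σ σ⁻¹ inverseʳ inverseˡ = begin
  sumFin n (λ i → w (σ i))  ≡⟨ sumFin≡sum n _ ⟩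
  ℕ-Sum.sum (λ i → w (σ i)) ≡⟨ ℕ-Sum.sum-permute w σ-perm ⟨
  ℕ-Sum.sum w               ≡⟨ sumFin≡sum n w ⟨
  sumFin n w                ∎
  where σ-perm = Permutation.permutation σ σ⁻¹ inverseʳ inverseˡ

if-sumFin : ∀ n (b : Bool) (f : Fin n → ℕ) →
  (if b then sumFin n f else 0) ≡ sumFin n (λ i → if b then f i else 0)
if-sumFin n true  f = refl
if-sumFin n false f = sym (sumFin-zero n (λ _ → refl))

sumFin-fibres : ∀ k n (f : Fin k → Fin n) (b : Fin n → Bool) →
  sumFin n (λ c → if b c then countFin k (λ g → ⌊ f g ≟ c ⌋) else 0) ≡ countFin k (λ g → b (f g))
sumFin-fibres k n f b = begin
  sumFin n (λ c → if b c then countFin k (λ g → ⌊ f g ≟ c ⌋) else 0)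
    ≡⟨ sumFin-cong n (λ c → if-sumFin k (b c) _) ⟩
  sumFin n (λ c → sumFin k (λ g → if b c then 𝟙 ⌊ f g ≟ c ⌋ else 0))
    ≡⟨ sumFin-cong n (λ c → sumFin-cong k (λ g → if-swap-then (b c) ⌊ f g ≟ c ⌋)) ⟩
  sumFin n (λ c → sumFin k (λ g → if ⌊ f g ≟ c ⌋ then 𝟙 (b c) else 0))
    ≡⟨ sumFin-comm n k _ ⟩
  sumFin k (λ g → sumFin n (λ c → if ⌊ f g ≟ c ⌋ then 𝟙 (b c) else 0))
    ≡⟨ sumFin-cong k (λ g → sumFin-single n (f g) λ c fg≢c →
         cong (if_then _ else 0) (⌊≟⌋-false fg≢c)) ⟩
  sumFin k (λ g → if ⌊ f g ≟ f g ⌋ then 𝟙 (b (f g)) else 0)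
    ≡⟨ sumFin-cong k (λ g → cong (if_then 𝟙 (b (f g)) else 0) (⌊≟⌋-true {x = f g} refl)) ⟩
  countFin k (λ g → b (f g)) ∎
  where
  𝟙 : Bool → ℕ
  𝟙 p = if p then 1 else 0

countFin-const-true : ∀ n → countFin n (λ _ → true) ≡ n
countFin-const-true zero    = refl
countFin-const-true (suc n) = cong suc (countFin-const-true n)

countFin-pos : ∀ n (p : Fin n → Bool) i → p i ≡ true → 0 < countFin n p
countFin-pos (suc n) p zero    pᵢ rewrite pᵢ = s≤s z≤n
countFin-pos (suc n) p (suc i) pᵢ =
  ≤-trans (countFin-pos n (λ j → p (suc j)) i pᵢ) (m≤n+m _ (if p zero then 1 else 0))

inverseˡ⇒inverseʳ : ∀ {A : Set} {f g f⁻¹ : A → A} →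
  (∀ x → g (f x) ≡ x) → (∀ y → f (f⁻¹ y) ≡ y) → ∀ y → f (g y) ≡ y
inverseˡ⇒inverseʳ {f = f} {g} {f⁻¹} g∘f f∘f⁻¹ y = begin
  f (g y)             ≡⟨ cong (λ z → f (g z)) (f∘f⁻¹ y) ⟨
  f (g (f (f⁻¹ y)))   ≡⟨ cong f (g∘f (f⁻¹ y)) ⟩
  f (f⁻¹ y)           ≡⟨ f∘f⁻¹ y ⟩
  y                   ∎

another : ∀ {n} → n ≢ 1 → (a : Fin n) → ∃ λ b → a ≢ b
another {suc zero}    n≢1 a       = ⊥-elim (n≢1 refl)
another {suc (suc n)} n≢1 zero    = suc zero , λ ()
another {suc (suc n)} n≢1 (suc a) = zero , λ ()

module _ {D : LengthDomain} (M : Model D) where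

  Joins-sym : ∀ {e x y} → Joins M e x y → Joins M e y x
  Joins-sym (inj₁ p) = inj₂ p
  Joins-sym (inj₂ p) = inj₁ p

  incident?-Joins : ∀ {e x y} z → Joins M e x y → incident? M e z ≡ ⌊ x ≟ z ⌋ ∨ ⌊ y ≟ z ⌋
  incident?-Joins {x = x} {y} z (inj₁ (refl , refl)) = refl
  incident?-Joins {x = x} {y} z (inj₂ (refl , refl)) = ∨-comm ⌊ y ≟ z ⌋ ⌊ x ≟ z ⌋

  Incident-Joins : ∀ {e x y z} → Incident M e z → Joins M e x y → x ≡ z ⊎ y ≡ z
  Incident-Joins (inj₁ s≡z) (inj₁ (s≡x , _)) = inj₁ (trans (sym s≡x) s≡z)
  Incident-Joins (inj₂ t≡z) (inj₁ (_ , t≡y)) = inj₂ (trans (sym t≡y) t≡z)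
  Incident-Joins (inj₁ s≡z) (inj₂ (s≡y , _)) = inj₂ (trans (sym s≡y) s≡z)
  Incident-Joins (inj₂ t≡z) (inj₂ (_ , t≡x)) = inj₁ (trans (sym t≡x) t≡z)

module Action {D : LengthDomain} {M : Model D} (K : Subgroup M) where
  open Subgroup K

  actV : Fin k → Fin (Model.nV M) → Fin (Model.nV M)
  actV g = Aut.fV (elt g)

  actE : Fin k → Fin (Model.nE M) → Fin (Model.nE M)
  actE g = Aut.fE (elt g)

  _∙_ : Fin k → Fin k → Fin k
  g ∙ h = proj₁ (closed g h)

  _⁻¹ : Fin k → Fin k
  h ⁻¹ = proj₁ (has-inv h)

  IsActionBy : ∀ {n} → (Fin k → Fin n → Fin n) → Set
  IsActionBy act = ∀ g h x → act (g ∙ h) x ≡ act g (act h x)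

  actV-∙ : IsActionBy actV
  actV-∙ g h = proj₁ (proj₂ (closed g h))

  actE-∙ : IsActionBy actE
  actE-∙ g h = proj₂ (proj₂ (closed g h))

  actV-inverseˡ : ∀ h x → actV (h ⁻¹) (actV h x) ≡ x
  actV-inverseˡ h = proj₁ (proj₂ (has-inv h))

  actE-inverseˡ : ∀ h x → actE (h ⁻¹) (actE h x) ≡ x
  actE-inverseˡ h = proj₂ (proj₂ (has-inv h))

  actV-inverseʳ : ∀ h x → actV h (actV (h ⁻¹) x) ≡ x
  actV-inverseʳ h = inverseˡ⇒inverseʳ {f = actV h} (actV-inverseˡ h) (Aut.fV-inv₂ (elt h))

  actE-inverseʳ : ∀ h x → actE h (actE (h ⁻¹) x) ≡ x
  actE-inverseʳ h = inverseˡ⇒inverseʳ {f = actE h} (actE-inverseˡ h) (Aut.fE-inv₂ (elt h))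

  act-∙-cancelʳ : ∀ {n} {act : Fin k → Fin n → Fin n} → IsActionBy act →
    ∀ {h h′} → (∀ x → act h′ (act h x) ≡ x) → ∀ g x → act ((g ∙ h′) ∙ h) x ≡ act g x
  act-∙-cancelʳ {act = act} act-∙ {h} {h′} h′∘h≗id g x = begin
    act ((g ∙ h′) ∙ h) x    ≡⟨ act-∙ (g ∙ h′) h x ⟩
    act (g ∙ h′) (act h x)  ≡⟨ act-∙ g h′ (act h x) ⟩
    act g (act h′ (act h x)) ≡⟨ cong (act g) (h′∘h≗id x) ⟩
    act g x                 ∎

  ∙-cancelʳ : ∀ {h h′} → (∀ x → actV h′ (actV h x) ≡ x) → (∀ e → actE h′ (actE h e) ≡ e) →
    ∀ g → (g ∙ h′) ∙ h ≡ g
  ∙-cancelʳ onV onE g = distinct _ g (act-∙-cancelʳ actV-∙ onV g , act-∙-cancelʳ actE-∙ onE g)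

  sumFin-∙ʳ : ∀ h (w : Fin k → ℕ) → sumFin k (λ g → w (g ∙ h)) ≡ sumFin k w
  sumFin-∙ʳ h w = sumFin-permute k w (_∙ h) (_∙ (h ⁻¹))
    (∙-cancelʳ (actV-inverseˡ h) (actE-inverseˡ h))
    (∙-cancelʳ (actV-inverseʳ h) (actE-inverseʳ h))

  transporters : ∀ {n} → (Fin k → Fin n → Fin n) → Fin n → Fin n → ℕ
  transporters act a c = countFin k (λ g → ⌊ act g a ≟ c ⌋)

  transporters-shift : ∀ {n} {act : Fin k → Fin n → Fin n} → IsActionBy act →
    ∀ {h a b} c → act h a ≡ b → transporters act b c ≡ transporters act a c
  transporters-shift {act = act} act-∙ {h} {a} {b} c ha≡b = begin
    sumFin k (λ g → 𝟙 (act g b))         ≡⟨ sumFin-cong k (λ g → cong 𝟙 (ghb≡gb g)) ⟨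
    sumFin k (λ g → 𝟙 (act (g ∙ h) a))   ≡⟨ sumFin-∙ʳ h (λ g → 𝟙 (act g a)) ⟩
    sumFin k (λ g → 𝟙 (act g a))         ∎
    where
    𝟙 : _ → ℕ
    𝟙 y = if ⌊ y ≟ c ⌋ then 1 else 0
    ghb≡gb : ∀ g → act (g ∙ h) a ≡ act g b
    ghb≡gb g = trans (act-∙ g h a) (cong (act g) ha≡b)

  transporters-zero : ∀ {n} {act : Fin k → Fin n → Fin n} {a c} →
    (∀ g → act g a ≢ c) → transporters act a c ≡ 0
  transporters-zero ga≢c = sumFin-zero k (λ g → cong (if_then 1 else 0) (⌊≟⌋-false (ga≢c g)))

  0<stabilizerV : ∀ x → 0 < transporters actV x x
  0<stabilizerV x = countFin-pos k _ (proj₁ has-id) (⌊≟⌋-true (proj₁ (proj₂ has-id) x))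

  Joins-act : ∀ g {e x y} → Joins M e x y → Joins M (actE g e) (actV g x) (actV g y)
  Joins-act g (inj₁ (refl , refl)) = Aut.incid (elt g) _
  Joins-act g (inj₂ (refl , refl)) = Joins-sym M (Aut.incid (elt g) _)

module Quotient {D : LengthDomain} {M : Model D} (K : Subgroup M) {M′ : Model D} {π : Map M M′}
                (Q : IsQuotient K M′ π) where
  open Model M using (src; tgt)
  open Subgroup K using (k)
  open Action K
  open Map π
  open IsQuotient Q

  ends-apart : ∀ {e e′} → φE e ≡ inj₂ e′ → φV (src e) ≢ φV (tgt e)
  ends-apart {e} eq same with () ← trans (sym (E-vert e (V-ker₁ _ _ same))) eq

  ends-collapse : ∀ e v → φE e ≡ inj₁ v → φV (src e) ≡ v × φV (tgt e) ≡ v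
  ends-collapse e v eq with φV (src e) ≟ φV (tgt e)
  ... | yes same = s≡v , trans (sym same) s≡v
    where s≡v = inj₁-injective (trans (sym (E-vert e (V-ker₁ _ _ same))) eq)
  ... | no apart with E-edge e (λ equiv → apart (V-ker₂ _ _ equiv))
  ...   | _ , eq′ with () ← trans (sym eq) eq′

  quotientMorphism : IsMorphism π
  quotientMorphism = record
    { μ      = stab K
    ; toVert = ends-collapse
    ; toEdge = λ e e′ eq → E-ends e e′ eq , E-len e e′ eq
    }

  module Over (e′ : Fin (Model.nE M′)) where
    e₀ : Fin (Model.nE M)
    e₀ = proj₁ (E-surj e′)

    e₀↦e′ : φE e₀ ≡ inj₂ e′
    e₀↦e′ = proj₂ (E-surj e′)

    lies-over? : Fin (Model.nE M) → Bool
    lies-over? e = hits? {D} {Model.nV M′} (φE e) e′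

    lies-over?-true : ∀ e → lies-over? e ≡ true → φE e ≡ inj₂ e′
    lies-over?-true e eq with φE e
    ... | inj₂ e″ with e″ ≟ e′
    ...   | yes refl = refl

    lies-over?-false : ∀ e → lies-over? e ≡ false → φE e ≢ inj₂ e′
    lies-over?-false e eq e↦e′ rewrite e↦e′ with e′ ≟ e′
    ... | no e′≢e′ = e′≢e′ refl

    -- Orbit–stabiliser: the edges over e′ form the K-orbit of e₀.
    stab-over : ∀ e → (if lies-over? e then stab K e else 0) ≡ transporters actE e₀ e
    stab-over e with lies-over? e in eq
    ... | true  = let (h , he₀≡e) = E-ker₁ e₀ e e′ e₀↦e′ (lies-over?-true e eq)
                  in transporters-shift actE-∙ e he₀≡e
    ... | false = sym (transporters-zero {act = actE} λ g ge₀≡e →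
                    lies-over?-false e eq (E-ker₂ e₀ e e′ e₀↦e′ (g , ge₀≡e)))

    degree : degAt quotientMorphism e′ ≡ k
    degree = begin
      sumFin (Model.nE M) (λ e → if lies-over? e then stab K e else 0)
        ≡⟨ sumFin-cong (Model.nE M) stab-over ⟩
      sumFin (Model.nE M) (transporters actE e₀)
        ≡⟨ sumFin-fibres k (Model.nE M) (λ g → actE g e₀) (λ _ → true) ⟩
      countFin k (λ _ → true)
        ≡⟨ countFin-const-true k ⟩
      k ∎

    end-over : ∀ {x} → Incident M′ e′ (φV x) →
      ∃₂ λ u w → Joins M e₀ u w × φV u ≡ φV x × φV w ≢ φV x
    end-over inc with Incident-Joins M′ inc (E-ends e₀ e′ e₀↦e′)
    ... | inj₁ s₀↦x = _ , _ , inj₁ (refl , refl) , s₀↦x , λ t₀↦x → apart (trans s₀↦x (sym t₀↦x))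
      where apart = ends-apart e₀↦e′
    ... | inj₂ t₀↦x = _ , _ , inj₂ (refl , refl) , t₀↦x , λ s₀↦x → apart (trans s₀↦x (sym t₀↦x))
      where apart = ends-apart e₀↦e′

    mult-over : ∀ x → Incident M′ e′ (φV x) → mult quotientMorphism x e′ ≡ transporters actV x x
    mult-over x inc with end-over inc
    ... | u , w , J , u↦x , w↦̸x = begin
      sumFin (Model.nE M) (λ e → if incident? M e x ∧ lies-over? e then stab K e else 0)
        ≡⟨ sumFin-cong (Model.nE M) (λ e → trans (if-∧ (incident? M e x))
             (cong (if incident? M e x then_else 0) (stab-over e))) ⟩
      sumFin (Model.nE M) (λ e → if incident? M e x then transporters actE e₀ e else 0)
        ≡⟨ sumFin-fibres k (Model.nE M) (λ g → actE g e₀) (λ e → incident? M e x) ⟩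
      countFin k (λ g → incident? M (actE g e₀) x)
        ≡⟨ sumFin-cong k (λ g → cong (if_then 1 else 0) (incident-translate g)) ⟩
      transporters actV u x
        ≡⟨ transporters-shift actV-∙ x (proj₂ (V-ker₁ x u (sym u↦x))) ⟩
      transporters actV x x ∎
      where
      incident-translate : ∀ g → incident? M (actE g e₀) x ≡ ⌊ actV g u ≟ x ⌋
      incident-translate g = begin
        incident? M (actE g e₀) x            ≡⟨ incident?-Joins M x (Joins-act g J) ⟩
        ⌊ actV g u ≟ x ⌋ ∨ ⌊ actV g w ≟ x ⌋  ≡⟨ cong (⌊ actV g u ≟ x ⌋ ∨_) (⌊≟⌋-false gw≢x) ⟩
        ⌊ actV g u ≟ x ⌋ ∨ false             ≡⟨ ∨-identityʳ _ ⟩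
        ⌊ actV g u ≟ x ⌋                     ∎
        where
        gw≢x : actV g w ≢ x
        gw≢x gw≡x = w↦̸x (V-ker₂ w x (g , gw≡x))

  path-crosses-orbits : ∀ {x y} → Path M x y → φV x ≢ φV y →
    ∃ λ e → ¬ VEquiv K (src e) (tgt e)
  path-crosses-orbits here x≢y = ⊥-elim (x≢y refl)
  path-crosses-orbits {x} (step {y = y} e J p) x≢z with φV x ≟ φV y
  ... | yes x≡y = path-crosses-orbits p (λ y≡z → x≢z (trans x≡y y≡z))
  ... | no  x≢y = e , λ equiv → x≢y (orbits-of-ends J (V-ker₂ _ _ equiv))
    where
    orbits-of-ends : Joins M e x y → φV (src e) ≡ φV (tgt e) → φV x ≡ φV y
    orbits-of-ends (inj₁ (refl , refl)) eq = eq
    orbits-of-ends (inj₂ (refl , refl)) eq = sym eq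

  quotient-has-edge : Connected M → Model.nV M′ ≢ 1 → Fin (Model.nE M′)
  quotient-has-edge (0<nV , path) nV′≢1 =
    let x₀          = fromℕ< 0<nV
        (v , x₀≢v)  = another nV′≢1 (φV x₀)
        (y , y↦v)   = V-surj v
        (e , apart) = path-crosses-orbits (path x₀ y) (λ x₀≡y → x₀≢v (trans x₀≡y y↦v))
    in proj₁ (E-edge e apart)

lemma2p2 : (D : LengthDomain) (M : Model D) → Connected M →
           (K : Subgroup M) (M' : Model D) (π : Map M M') → IsQuotient K M' π →
           Σ (IsMorphism π) (λ φ → IsHarmonic φ ×
             (¬ (Model.nV M' ≡ 1) → IsNondegenerate φ × HasDegree φ (Subgroup.k K)))
lemma2p2 D M connected K M' π Q =
  quotientMorphism , harmonic , λ nV′≢1 → nondegenerate , degree , edgeless⇒k≡0 nV′≢1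
  where
  open Quotient K Q
  open Over using (degree; mult-over)
  open Action K using (0<stabilizerV)

  harmonic : IsHarmonic quotientMorphism
  harmonic x e₁ e₂ inc₁ inc₂ = trans (mult-over e₁ x inc₁) (sym (mult-over e₂ x inc₂))

  nondegenerate : IsNondegenerate quotientMorphism
  nondegenerate x e′ inc = subst (0 <_) (sym (mult-over e′ x inc)) (0<stabilizerV x)

  edgeless⇒k≡0 : ¬ (Model.nV M' ≡ 1) → Model.nE M' ≡ 0 → Subgroup.k K ≡ 0
  edgeless⇒k≡0 nV′≢1 nE′≡0 = ⊥-elim (¬Fin0 (subst Fin nE′≡0 (quotient-has-edge connected nV′≢1)))
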